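{- Let $k\ge2$ and let $a_1,\ldots,a_{k-1}$ be integers. Let $P$ be the set of integer sequences $(\lambda_1,\ldots,\lambda_k)$ satisfying $\lambda_1\ge\sum_{i=1}^{k-1}a_i\lambda_{i+1}$, $\lambda_i\ge\lambda_{i+1}$ for $2\le i\le k-1$, and $\lambda_k\ge0$. If every element of $P$ has all entries nonnegative, then \[\sum_{\lambda\in P}q^{\lambda_1+\cdots+\lambda_k}=\frac{1}{1-q}\prod_{i=1}^{k-1}\frac{1}{1-q^{\,i+a_1+\cdots+a_i}}.\] -}

module Defs where

open import Data.Nat as ℕ using (ℕ; zero; suc; _∸_; _≤ᵇ_)
open import Data.Integer as ℤ using (ℤ; +_; _+_; _*_; _-_; _≤_; _≟_)
open import Data.Fin using (Fin; zero; suc; toℕ; inject₁; fromℕ)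
open import Data.Vec using (Vec; lookup)
open import Data.Bool using (if_then_else_)
open import Data.Product using (_×_)
open import Relation.Nullary using (does)

sumFin : ∀ {m} → (Fin m → ℤ) → ℤ
sumFin {zero}  f = + 0
sumFin {suc m} f = f zero + sumFin (λ i → f (suc i))

-- The set P.  k = suc m with m ≥ 1; indices are 0-based:
--   λ_j (1-based) = lookup lam (j-1),   a_i (1-based) = a (i-1).

InP : ∀ {m} → (Fin m → ℤ) → Vec ℤ (suc m) → Set
InP {m} a lam =
  (sumFin (λ i → a i * lookup lam (suc i)) ≤ lookup lam zero)
  × ((j : Fin m) → 1 ℕ.≤ toℕ j → lookup lam (suc j) ≤ lookup lam (inject₁ j))
  × (+ 0 ≤ lookup lam (fromℕ m))

weight : ∀ {k} → Vec ℤ k → ℤ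
weight {k} lam = sumFin (λ i → lookup lam i)

-- Formal power series in q with integer coefficients, as coefficient
-- sequences.

Series : Set
Series = ℕ → ℤ

_≈ₛ_ : Series → Series → Set
f ≈ₛ g = ∀ n → f n ≡ g n
  where open import Relation.Binary.PropositionalEquality using (_≡_)

oneₛ : Series
oneₛ zero    = + 1
oneₛ (suc n) = + 0

-- q^e for an integer exponent e (the zero series if e < 0; in the
-- theorem all exponents used are ≥ 1 under the hypothesis).
qpow : ℤ → Series
qpow e n = if does (+ n ≟ e) then + 1 else + 0

_-ₛ_ : Series → Series → Series
(f -ₛ g) n = f n - g n

_*ₛ_ : Series → Series → Series
(f *ₛ g) n = sumFin {suc n} (λ i → f (toℕ i) * g (n ∸ toℕ i))

prodFin : ∀ {m} → (Fin m → Series) → Series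
prodFin {zero}  f = oneₛ
prodFin {suc m} f = f zero *ₛ prodFin (λ i → f (suc i))

-- exponent i + a_1 + ... + a_i for the (0-based) index j = i - 1
expo : ∀ {m} → (Fin m → ℤ) → Fin m → ℤ
expo a j = + suc (toℕ j) + sumFin (λ t → if toℕ t ≤ᵇ toℕ j then a t else + 0)

denominator : ∀ {m} → (Fin m → ℤ) → Series
denominator a = (oneₛ -ₛ qpow (+ 1)) *ₛ prodFin (λ j → oneₛ -ₛ qpow (expo a j))

module Submission where

open import Defs
open import Data.Nat using (ℕ; suc; _≤_)
open import Data.Integer using (ℤ; +_)
open import Data.Fin using (Fin)
open import Data.Vec using (Vec; lookup)
open import Data.List using (List; length)
open import Data.List.Membership.Propositional using (_∈_)
open import Data.List.Relation.Unary.Unique.Propositional using (Unique)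
open import Data.Product using (Σ; _×_)
open import Function.Bundles using (_⇔_)
open import Relation.Binary.PropositionalEquality using (_≡_)

-- Writing the tail λ₂ ≥ ⋯ ≥ λₖ ≥ 0 as the suffix sums of μ ∈ ℕᵏ⁻¹ and λ₁ as
-- t + Σ aᵢ λᵢ₊₁ with t ∈ ℕ identifies P with ℕᵏ, and summation by parts turns the
-- weight into t + Σⱼ eⱼ μⱼ with eⱼ = j + a₁ + ⋯ + aⱼ.  Applying the hypothesis to the
-- images of unit vectors gives a₁ + ⋯ + aⱼ ≥ 0, so every eⱼ ≥ 1 and the elements of P
-- of weight n correspond to the partitions of n into parts 1, e₁, …, eₖ₋₁, recorded
-- by multiplicities.  Their count F satisfies F = G + q^e F, where e is the first part
-- and G counts the partitions without it, so F · (1 − q^e) = G, and induction on the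
-- parts yields the product formula.

module IntegerSums where

  open import Data.Nat using (zero; suc)
  open import Data.Integer using (_+_; _*_; _-_)
  import Data.Integer.Properties as ℤ
  open import Data.Integer.Tactic.RingSolver using (solve-∀)
  open import Algebra.Properties.CommutativeSemigroup ℤ.+-commutativeSemigroup using (interchange)
  open import Algebra.Properties.AbelianGroup ℤ.+-0-abelianGroup
    using (//-rightDividesˡ; //-rightDividesʳ)
  open import Data.Fin using (zero; suc)
  open import Function using (_∘_)
  open import Relation.Binary.PropositionalEquality using (refl; trans; cong; cong₂)

  x+y-y≡x : ∀ x y → x + y - y ≡ x
  x+y-y≡x x y = //-rightDividesʳ y x

  x-y+y≡x : ∀ x y → x - y + y ≡ x
  x-y+y≡x x y = //-rightDividesˡ y x

  sumFin-cong : ∀ {m} {f g : Fin m → ℤ} → (∀ i → f i ≡ g i) → sumFin f ≡ sumFin g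
  sumFin-cong {zero}  f≡g = refl
  sumFin-cong {suc m} f≡g = cong₂ _+_ (f≡g zero) (sumFin-cong (f≡g ∘ suc))

  sumFin-zero : ∀ {m} {f : Fin m → ℤ} → (∀ i → f i ≡ + 0) → sumFin f ≡ + 0
  sumFin-zero {zero}  f≡0 = refl
  sumFin-zero {suc m} f≡0 = cong₂ _+_ (f≡0 zero) (sumFin-zero (f≡0 ∘ suc))

  sumFin-+ : ∀ {m} (f g : Fin m → ℤ) → sumFin (λ i → f i + g i) ≡ sumFin f + sumFin g
  sumFin-+ {zero}  f g = refl
  sumFin-+ {suc m} f g = trans (cong (_+_ (f zero + g zero)) (sumFin-+ (f ∘ suc) (g ∘ suc)))
                               (interchange (f zero) (g zero) (sumFin (f ∘ suc)) (sumFin (g ∘ suc)))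

  sumFin-- : ∀ {m} (f g : Fin m → ℤ) → sumFin (λ i → f i - g i) ≡ sumFin f - sumFin g
  sumFin-- {zero}  f g = refl
  sumFin-- {suc m} f g = trans (cong (_+_ (f zero - g zero)) (sumFin-- (f ∘ suc) (g ∘ suc)))
                               (-interchange (f zero) (g zero) (sumFin (f ∘ suc)) (sumFin (g ∘ suc)))
    where
    -interchange : ∀ a b c d → (a - b) + (c - d) ≡ (a + c) - (b + d)
    -interchange = solve-∀

  *-distribˡ-sumFin : ∀ {m} c (f : Fin m → ℤ) → c * sumFin f ≡ sumFin (λ i → c * f i)
  *-distribˡ-sumFin {zero}  c f = ℤ.*-zeroʳ c
  *-distribˡ-sumFin {suc m} c f =
    trans (ℤ.*-distribˡ-+ c (f zero) (sumFin (f ∘ suc)))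
          (cong (_+_ (c * f zero)) (*-distribˡ-sumFin c (f ∘ suc)))

module FormalSeries where

  open IntegerSums
  open import Data.Nat as ℕ using (zero; suc; _∸_; z≤n; s≤s)
  open import Data.Integer using (_+_; _*_; _-_)
  import Data.Integer.Properties as ℤ
  open import Algebra.Properties.Ring ℤ.+-*-ring using (x[y-z]≈xy-xz; [y-z]x≈yx-zx)
  open import Data.Fin using (zero; suc; toℕ)
  open import Function using (_∘_)
  open import Relation.Nullary using (¬_; contradiction)
  open import Relation.Binary.Bundles using (Setoid)
  import Relation.Binary.Reasoning.Setoid as SetoidReasoning
  open import Relation.Binary.PropositionalEquality
    using (refl; trans; cong; cong₂; _→-setoid_; module ≡-Reasoning)

  _+ₛ_ : Series → Series → Series
  (F +ₛ G) n = F n + G n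

  module ≈ₛ-Reasoning = SetoidReasoning (ℕ →-setoid ℤ)

  open Setoid (ℕ →-setoid ℤ) public using () renaming (refl to ≈ₛ-refl; trans to ≈ₛ-trans)

  -ₛ-cong : ∀ {F F′ G G′} → F ≈ₛ F′ → G ≈ₛ G′ → (F -ₛ G) ≈ₛ (F′ -ₛ G′)
  -ₛ-cong F≈F′ G≈G′ n = cong₂ _-_ (F≈F′ n) (G≈G′ n)

  *ₛ-cong : ∀ {F F′ G G′} → F ≈ₛ F′ → G ≈ₛ G′ → (F *ₛ G) ≈ₛ (F′ *ₛ G′)
  *ₛ-cong F≈F′ G≈G′ n =
    sumFin-cong {suc n} (λ i → cong₂ _*_ (F≈F′ (toℕ i)) (G≈G′ (n ∸ toℕ i)))

  *ₛ-identityˡ : ∀ H → (oneₛ *ₛ H) ≈ₛ H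
  *ₛ-identityˡ H n = begin
    + 1 * H n + sumFin {n} (λ i → + 0 * H (n ∸ suc (toℕ i)))
      ≡⟨ cong₂ _+_ (ℤ.*-identityˡ (H n))
                   (sumFin-zero {n} (λ i → ℤ.*-zeroˡ (H (n ∸ suc (toℕ i))))) ⟩
    H n + + 0
      ≡⟨ ℤ.+-identityʳ (H n) ⟩
    H n ∎
    where open ≡-Reasoning

  *ₛ-distribʳ--ₛ : ∀ F G H → ((F -ₛ G) *ₛ H) ≈ₛ ((F *ₛ H) -ₛ (G *ₛ H))
  *ₛ-distribʳ--ₛ F G H n =
    trans (sumFin-cong {suc n} (λ i → [y-z]x≈yx-zx (H (n ∸ toℕ i)) (F (toℕ i)) (G (toℕ i))))
          (sumFin-- {suc n} (λ i → F (toℕ i) * H (n ∸ toℕ i))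
                            (λ i → G (toℕ i) * H (n ∸ toℕ i)))

  *ₛ-distribˡ--ₛ : ∀ F G H → (F *ₛ (G -ₛ H)) ≈ₛ ((F *ₛ G) -ₛ (F *ₛ H))
  *ₛ-distribˡ--ₛ F G H n =
    trans (sumFin-cong {suc n} (λ i → x[y-z]≈xy-xz (F (toℕ i)) (G (n ∸ toℕ i)) (H (n ∸ toℕ i))))
          (sumFin-- {suc n} (λ i → F (toℕ i) * G (n ∸ toℕ i))
                            (λ i → F (toℕ i) * H (n ∸ toℕ i)))

  *ₛ-congˡ : ∀ {F F′} H → F ≈ₛ F′ → (F *ₛ H) ≈ₛ (F′ *ₛ H)
  *ₛ-congˡ H F≈F′ = *ₛ-cong F≈F′ (≈ₛ-refl {H})

  *ₛ-congʳ : ∀ F {G G′} → G ≈ₛ G′ → (F *ₛ G) ≈ₛ (F *ₛ G′)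
  *ₛ-congʳ F G≈G′ = *ₛ-cong (≈ₛ-refl {F}) G≈G′

  -ₛ-congʳ : ∀ F {G G′} → G ≈ₛ G′ → (F -ₛ G) ≈ₛ (F -ₛ G′)
  -ₛ-congʳ F = -ₛ-cong (≈ₛ-refl {F})

  prodFin-cong : ∀ {m} {F G : Fin m → Series} → (∀ j → F j ≈ₛ G j) → prodFin F ≈ₛ prodFin G
  prodFin-cong {zero}  F≈G = ≈ₛ-refl
  prodFin-cong {suc m} F≈G = *ₛ-cong (F≈G zero) (prodFin-cong (F≈G ∘ suc))

  shift : ℕ → Series → Series
  shift zero    F n       = F n
  shift (suc e) F zero    = + 0
  shift (suc e) F (suc n) = shift e F n

  shift-cong : ∀ e {F G} → F ≈ₛ G → shift e F ≈ₛ shift e G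
  shift-cong zero    F≈G n       = F≈G n
  shift-cong (suc e) F≈G zero    = refl
  shift-cong (suc e) F≈G (suc n) = shift-cong e F≈G n

  shift-≤ : ∀ e F {n} → e ℕ.≤ n → shift e F n ≡ F (n ∸ e)
  shift-≤ zero    F e≤n       = refl
  shift-≤ (suc e) F (s≤s e≤n) = shift-≤ e F e≤n

  shift-≰ : ∀ e F {n} → ¬ e ℕ.≤ n → shift e F n ≡ + 0
  shift-≰ zero    F {n}     e≰n = contradiction z≤n e≰n
  shift-≰ (suc e) F {zero}  e≰n = refl
  shift-≰ (suc e) F {suc n} e≰n = shift-≰ e F (e≰n ∘ s≤s)

  shiftˡ-*ₛ : ∀ e F H → (shift e F *ₛ H) ≈ₛ shift e (F *ₛ H)
  shiftˡ-*ₛ zero    F H n       = refl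
  shiftˡ-*ₛ (suc e) F H zero    = ℤ.+-identityʳ (+ 0 * H 0)
  shiftˡ-*ₛ (suc e) F H (suc n) =
    trans (cong (_+ (shift e F *ₛ H) n) (ℤ.*-zeroˡ (H (suc n))))
          (trans (ℤ.+-identityˡ _) (shiftˡ-*ₛ e F H n))

  shiftʳ-*ₛ : ∀ e F H → (F *ₛ shift e H) ≈ₛ shift e (F *ₛ H)
  shiftʳ-*ₛ zero    F H n       = refl
  shiftʳ-*ₛ (suc e) F H zero    = trans (ℤ.+-identityʳ (F 0 * + 0)) (ℤ.*-zeroʳ (F 0))
  shiftʳ-*ₛ (suc e) F H (suc n) = trans (convolve-suc F n) (shiftʳ-*ₛ e F H n)
    where
    convolve-suc : ∀ F n → (F *ₛ shift (suc e) H) (suc n) ≡ (F *ₛ shift e H) n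
    convolve-suc F zero    =
      cong (_+_ (F 0 * shift e H 0)) (trans (ℤ.+-identityʳ (F 1 * + 0)) (ℤ.*-zeroʳ (F 1)))
    convolve-suc F (suc n) = cong (_+_ (F 0 * shift e H (suc n))) (convolve-suc (F ∘ suc) n)

  qpow≈shift-oneₛ : ∀ e → qpow (+ e) ≈ₛ shift e oneₛ
  qpow≈shift-oneₛ zero    zero    = refl
  qpow≈shift-oneₛ zero    (suc n) = refl
  qpow≈shift-oneₛ (suc e) zero    = refl
  qpow≈shift-oneₛ (suc e) (suc n) = qpow≈shift-oneₛ e n

  qpow-*ₛ : ∀ e H → (qpow (+ e) *ₛ H) ≈ₛ shift e H
  qpow-*ₛ e H = begin
    qpow (+ e) *ₛ H       ≈⟨ *ₛ-congˡ H (qpow≈shift-oneₛ e) ⟩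
    shift e oneₛ *ₛ H     ≈⟨ shiftˡ-*ₛ e oneₛ H ⟩
    shift e (oneₛ *ₛ H)   ≈⟨ shift-cong e (*ₛ-identityˡ H) ⟩
    shift e H             ∎
    where open ≈ₛ-Reasoning

  -- Stated with an extra factor H so that no associativity of *ₛ is needed.
  *ₛ-[1-qpow] : ∀ e F G H → F ≈ₛ (G +ₛ shift e F) →
                (F *ₛ ((oneₛ -ₛ qpow (+ e)) *ₛ H)) ≈ₛ (G *ₛ H)
  *ₛ-[1-qpow] e F G H F≈G+qᵉF = begin
    F *ₛ ((oneₛ -ₛ qpow (+ e)) *ₛ H)
      ≈⟨ *ₛ-congʳ F (*ₛ-distribʳ--ₛ oneₛ (qpow (+ e)) H) ⟩
    F *ₛ ((oneₛ *ₛ H) -ₛ (qpow (+ e) *ₛ H))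
      ≈⟨ *ₛ-congʳ F (-ₛ-cong (*ₛ-identityˡ H) (qpow-*ₛ e H)) ⟩
    F *ₛ (H -ₛ shift e H)
      ≈⟨ *ₛ-distribˡ--ₛ F H (shift e H) ⟩
    (F *ₛ H) -ₛ (F *ₛ shift e H)
      ≈⟨ -ₛ-congʳ (F *ₛ H) (shiftʳ-*ₛ e F H) ⟩
    (F *ₛ H) -ₛ shift e (F *ₛ H)
      ≈⟨ -ₛ-congʳ (F *ₛ H) (shiftˡ-*ₛ e F H) ⟨
    (F *ₛ H) -ₛ (shift e F *ₛ H)
      ≈⟨ *ₛ-distribʳ--ₛ F (shift e F) H ⟨
    (F -ₛ shift e F) *ₛ H
      ≈⟨ *ₛ-congˡ H F-qᵉF≈G ⟩
    G *ₛ H ∎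
    where
    open ≈ₛ-Reasoning
    F-qᵉF≈G : (F -ₛ shift e F) ≈ₛ G
    F-qᵉF≈G n = trans (cong (_- shift e F n) (F≈G+qᵉF n)) (x+y-y≡x (G n) (shift e F n))

module Partitions where

  open FormalSeries
  open import Data.Nat
  open import Data.Nat.Properties
  import Data.Integer as ℤ
  import Data.Integer.Properties as ℤ
  open import Data.Fin using (zero; suc)
  open import Data.Vec using ([]; _∷_)
  open import Data.Vec.Properties using (∷-injectiveʳ)
  open import Data.List using ([]; _∷_; [_]; _++_; map)
  open import Data.List.Properties using (length-++; length-map)
  open import Data.List.Relation.Unary.Any using (here)
  open import Data.List.Relation.Unary.All using ([])
  open import Data.List.Relation.Unary.AllPairs using ([]; _∷_)
  open import Data.List.Membership.Propositional.Properties
    using (∈-map⁺; ∈-map⁻; ∈-++⁺ˡ; ∈-++⁺ʳ; ∈-++⁻)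
  import Data.List.Relation.Unary.Unique.Propositional.Properties as Unique
  open import Data.Product using (_,_)
  open import Data.Sum using (inj₁; inj₂)
  open import Relation.Nullary using (¬_; yes; no; contradiction)
  open import Function using (_∘_)
  open import Relation.Binary.PropositionalEquality
    using (refl; sym; trans; cong; cong₂; module ≡-Reasoning)

  -- A part is stored as its predecessor p, so that every part is positive.
  size : ∀ {k} → Vec ℕ k → Vec ℕ k → ℕ
  size []       []       = 0
  size (p ∷ ps) (x ∷ xs) = x * suc p + size ps xs

  sucHead : ∀ {k} → Vec ℕ (suc k) → Vec ℕ (suc k)
  sucHead (x ∷ xs) = suc x ∷ xs

  sucHead-injective : ∀ {k} {x y : Vec ℕ (suc k)} → sucHead x ≡ sucHead y → x ≡ y
  sucHead-injective {x = _ ∷ _} {_ ∷ _} refl = refl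

  size-sucHead : ∀ {k} p (ps : Vec ℕ k) x →
                 size (p ∷ ps) (sucHead x) ≡ suc p + size (p ∷ ps) x
  size-sucHead p ps (x ∷ xs) = +-assoc (suc p) (x * suc p) (size ps xs)

  -- partitionsᶠ p ps f n is partitions (p ∷ ps) n whenever n ≤ f; the fuel f makes the
  -- recursion on n ∸ suc p structural.
  mutual
    partitions : ∀ {k} → Vec ℕ k → ℕ → List (Vec ℕ k)
    partitions []       zero    = [ [] ]
    partitions []       (suc n) = []
    partitions (p ∷ ps) n       = partitionsᶠ p ps n n

    partitionsᶠ : ∀ {k} → ℕ → Vec ℕ k → ℕ → ℕ → List (Vec ℕ (suc k))
    partitionsᶠ p ps f n = map (0 ∷_) (partitions ps n) ++ partitionsᶠ⁺ p ps f n

    partitionsᶠ⁺ : ∀ {k} → ℕ → Vec ℕ k → ℕ → ℕ → List (Vec ℕ (suc k))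
    partitionsᶠ⁺ p ps zero    n = []
    partitionsᶠ⁺ p ps (suc f) n with suc p ≤? n
    ... | yes _ = map sucHead (partitionsᶠ p ps f (n ∸ suc p))
    ... | no  _ = []

  mutual
    partitions-sound : ∀ {k} {ps : Vec ℕ k} {n x} → x ∈ partitions ps n → size ps x ≡ n
    partitions-sound {ps = []}     {zero} {[]} (here refl) = refl
    partitions-sound {ps = p ∷ ps} {n}                     = partitionsᶠ-sound {f = n}

    partitionsᶠ-sound : ∀ {k p} {ps : Vec ℕ k} {f n x} →
                         x ∈ partitionsᶠ p ps f n → size (p ∷ ps) x ≡ n
    partitionsᶠ-sound {ps = ps} {f} {n} x∈ with ∈-++⁻ (map (0 ∷_) (partitions ps n)) x∈
    ... | inj₂ x∈⁺ = partitionsᶠ⁺-sound {f = f} x∈⁺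
    ... | inj₁ x∈⁰ with ∈-map⁻ (0 ∷_) x∈⁰
    ...   | y , y∈ , refl = partitions-sound {ps = ps} y∈

    partitionsᶠ⁺-sound : ∀ {k p} {ps : Vec ℕ k} {f n x} →
                        x ∈ partitionsᶠ⁺ p ps f n → size (p ∷ ps) x ≡ n
    partitionsᶠ⁺-sound {p = p} {ps} {suc f} {n} x∈ with suc p ≤? n
    ... | yes p<n with ∈-map⁻ sucHead x∈
    ...   | y , y∈ , refl = begin
      size (p ∷ ps) (sucHead y)   ≡⟨ size-sucHead p ps y ⟩
      suc p + size (p ∷ ps) y     ≡⟨ cong (_+_ (suc p)) (partitionsᶠ-sound {f = f} y∈) ⟩
      suc p + (n ∸ suc p)         ≡⟨ m+[n∸m]≡n p<n ⟩
      n                           ∎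
      where open ≡-Reasoning

  fuel-∸ : ∀ {f n} p → n ≤ suc f → n ∸ suc p ≤ f
  fuel-∸ {f} {n} p n≤1+f = m≤n+o⇒m∸n≤o n (suc p) (≤-trans n≤1+f (s≤s (m≤n+m f p)))

  mutual
    partitions-complete : ∀ {k} {ps : Vec ℕ k} {n x} → size ps x ≡ n → x ∈ partitions ps n
    partitions-complete {ps = []}     {x = []} refl = here refl
    partitions-complete {ps = p ∷ ps} {n}          = partitionsᶠ-complete {f = n} ≤-refl

    partitionsᶠ-complete : ∀ {k p} {ps : Vec ℕ k} {f n x} →
                            n ≤ f → size (p ∷ ps) x ≡ n → x ∈ partitionsᶠ p ps f n
    partitionsᶠ-complete {ps = ps} {x = zero ∷ t} _ size≡n =
      ∈-++⁺ˡ (∈-map⁺ (0 ∷_) (partitions-complete {ps = ps} size≡n))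
    partitionsᶠ-complete {ps = ps} {n = n} {x = suc h ∷ t} n≤f size≡n =
      ∈-++⁺ʳ (map (0 ∷_) (partitions ps n)) (partitionsᶠ⁺-complete n≤f size≡n)

    partitionsᶠ⁺-complete : ∀ {k p} {ps : Vec ℕ k} {f n h t} →
                           n ≤ f → size (p ∷ ps) (suc h ∷ t) ≡ n →
                           (suc h ∷ t) ∈ partitionsᶠ⁺ p ps f n
    partitionsᶠ⁺-complete {f = zero} z≤n ()
    partitionsᶠ⁺-complete {p = p} {ps} {suc f} {n} {h} {t} n≤1+f size≡n with suc p ≤? n
    ... | yes _   = ∈-map⁺ sucHead (partitionsᶠ-complete {f = f} (fuel-∸ p n≤1+f) size-tail)
      where
      size-tail : size (p ∷ ps) (h ∷ t) ≡ n ∸ suc p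
      size-tail = trans (sym (m+n∸m≡n (suc p) _))
                        (cong (_∸ suc p) (trans (sym (size-sucHead p ps (h ∷ t))) size≡n))
    ... | no  p≮n = contradiction p<n p≮n
      where
      p<n : suc p ≤ n
      p<n = ≤-trans (m≤m+n (suc p) _)
                    (≤-reflexive (trans (sym (size-sucHead p ps (h ∷ t))) size≡n))

  mutual
    partitions-unique : ∀ {k} (ps : Vec ℕ k) n → Unique (partitions ps n)
    partitions-unique []       zero    = [] ∷ []
    partitions-unique []       (suc n) = []
    partitions-unique (p ∷ ps) n       = partitionsᶠ-unique p ps n n

    partitionsᶠ-unique : ∀ {k} p (ps : Vec ℕ k) f n → Unique (partitionsᶠ p ps f n)
    partitionsᶠ-unique p ps f n =
      Unique.++⁺ (Unique.map⁺ ∷-injectiveʳ (partitions-unique ps n))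
                 (partitionsᶠ⁺-unique p ps f n)
                 headZero∉partitionsᶠ⁺
      where
      headZero∉partitionsᶠ⁺ : ∀ {x} →
        ¬ (x ∈ map (0 ∷_) (partitions ps n) × x ∈ partitionsᶠ⁺ p ps f n)
      headZero∉partitionsᶠ⁺ (x∈⁰ , x∈⁺) with ∈-map⁻ (0 ∷_) x∈⁰
      ... | _ , _ , refl = partitionsᶠ⁺-headZero f n x∈⁺

    partitionsᶠ⁺-headZero : ∀ {k p} {ps : Vec ℕ k} f n {t} →
                            ¬ (0 ∷ t) ∈ partitionsᶠ⁺ p ps f n
    partitionsᶠ⁺-headZero {p = p} (suc f) n x∈ with suc p ≤? n
    ... | yes _ with ∈-map⁻ sucHead x∈
    ...   | _ ∷ _ , _ , ()

    partitionsᶠ⁺-unique : ∀ {k} p (ps : Vec ℕ k) f n → Unique (partitionsᶠ⁺ p ps f n)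
    partitionsᶠ⁺-unique p ps zero    n = []
    partitionsᶠ⁺-unique p ps (suc f) n with suc p ≤? n
    ... | yes _ = Unique.map⁺ sucHead-injective (partitionsᶠ-unique p ps f (n ∸ suc p))
    ... | no  _ = []

  mutual
    partitionsᶠ-fuel : ∀ {k} p (ps : Vec ℕ k) {f g n} → n ≤ f → n ≤ g →
                        partitionsᶠ p ps f n ≡ partitionsᶠ p ps g n
    partitionsᶠ-fuel p ps {n = n} n≤f n≤g =
      cong (map (0 ∷_) (partitions ps n) ++_) (partitionsᶠ⁺-fuel p ps n≤f n≤g)

    partitionsᶠ⁺-fuel : ∀ {k} p (ps : Vec ℕ k) {f g n} → n ≤ f → n ≤ g →
                       partitionsᶠ⁺ p ps f n ≡ partitionsᶠ⁺ p ps g n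
    partitionsᶠ⁺-fuel p ps {zero}  {zero}  _ _ = refl
    partitionsᶠ⁺-fuel p ps {zero}  {suc g} z≤n _ with suc p ≤? 0
    ... | no _ = refl
    partitionsᶠ⁺-fuel p ps {suc f} {zero}  _ z≤n with suc p ≤? 0
    ... | no _ = refl
    partitionsᶠ⁺-fuel p ps {suc f} {suc g} {n} n≤1+f n≤1+g with suc p ≤? n
    ... | yes _ = cong (map sucHead) (partitionsᶠ-fuel p ps (fuel-∸ p n≤1+f) (fuel-∸ p n≤1+g))
    ... | no  _ = refl

  +size : ∀ {k} (ps : Vec ℕ k) x →
          ℤ.+ size ps x ≡ sumFin (λ j → ℤ.+ suc (lookup ps j) ℤ.* ℤ.+ lookup x j)
  +size []       []       = refl
  +size (p ∷ ps) (x ∷ xs) = trans (ℤ.pos-+ (x * suc p) (size ps xs))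
    (cong₂ ℤ._+_ (trans (ℤ.pos-* x (suc p)) (ℤ.*-comm (ℤ.+ x) (ℤ.+ suc p))) (+size ps xs))

  partitionSeries : ∀ {k} → Vec ℕ k → Series
  partitionSeries ps n = ℤ.+ length (partitions ps n)

  partitionSeries-[] : partitionSeries [] ≈ₛ oneₛ
  partitionSeries-[] zero    = refl
  partitionSeries-[] (suc n) = refl

  length-partitionsᶠ⁺ : ∀ {k} p (ps : Vec ℕ k) n →
    ℤ.+ length (partitionsᶠ⁺ p ps n n) ≡ shift (suc p) (partitionSeries (p ∷ ps)) n
  length-partitionsᶠ⁺ p ps zero    = refl
  length-partitionsᶠ⁺ p ps (suc n) with suc p ≤? suc n
  ... | yes (s≤s p≤n) = trans
    (cong ℤ.+_ (trans (length-map sucHead (partitionsᶠ p ps n (n ∸ p)))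
                      (cong length (partitionsᶠ-fuel p ps (m∸n≤m n p) ≤-refl))))
    (sym (shift-≤ p (partitionSeries (p ∷ ps)) p≤n))
  ... | no  p≰n = sym (shift-≰ p (partitionSeries (p ∷ ps)) (p≰n ∘ s≤s))

  partitionSeries-∷ : ∀ {k} p (ps : Vec ℕ k) →
    partitionSeries (p ∷ ps) ≈ₛ (partitionSeries ps +ₛ shift (suc p) (partitionSeries (p ∷ ps)))
  partitionSeries-∷ p ps n = begin
    ℤ.+ length (zeroHead ++ partitionsᶠ⁺ p ps n n)
      ≡⟨ cong ℤ.+_ (length-++ zeroHead) ⟩
    ℤ.+ (length zeroHead + length (partitionsᶠ⁺ p ps n n))
      ≡⟨ ℤ.pos-+ (length zeroHead) _ ⟩
    ℤ.+ length zeroHead ℤ.+ ℤ.+ length (partitionsᶠ⁺ p ps n n)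
      ≡⟨ cong₂ ℤ._+_ (cong ℤ.+_ (length-map (0 ∷_) (partitions ps n)))
                     (length-partitionsᶠ⁺ p ps n) ⟩
    partitionSeries ps n ℤ.+ shift (suc p) (partitionSeries (p ∷ ps)) n ∎
    where
    open ≡-Reasoning
    zeroHead : List (Vec ℕ (suc _))
    zeroHead = map (0 ∷_) (partitions ps n)

  partitionSeries-generating : ∀ {k} (ps : Vec ℕ k) →
    (partitionSeries ps *ₛ prodFin (λ j → oneₛ -ₛ qpow (ℤ.+ suc (lookup ps j)))) ≈ₛ oneₛ
  partitionSeries-generating []       =
    ≈ₛ-trans (*ₛ-congˡ oneₛ partitionSeries-[]) (*ₛ-identityˡ oneₛ)
  partitionSeries-generating (p ∷ ps) =
    ≈ₛ-trans (*ₛ-[1-qpow] (suc p) (partitionSeries (p ∷ ps)) (partitionSeries ps) _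
                          (partitionSeries-∷ p ps))
             (partitionSeries-generating ps)

module Parametrisation where

  open IntegerSums
  open import Data.Nat as ℕ using (zero; suc; _≤ᵇ_; _<ᵇ_; s≤s; z≤n)
  open import Data.Integer.Tactic.RingSolver using (solve-∀)
  open import Data.Integer using (_+_; _*_; _-_; ∣_∣)
  import Data.Integer as ℤ
  import Data.Integer.Properties as ℤ
  open import Data.Fin using (zero; suc; toℕ; inject₁; fromℕ)
  open import Data.Vec using ([]; _∷_; replicate)
  open import Data.Vec.Properties using (lookup-replicate)
  open import Data.Bool using (if_then_else_)
  open import Data.Product using (_,_; proj₁; proj₂)
  open import Data.Unit using (⊤; tt)
  open import Function using (_∘_)
  open import Function.Bundles using (mk⇔; Equivalence)
  open import Relation.Binary.PropositionalEquality
    using (refl; sym; trans; cong; cong₂; subst; module ≡-Reasoning)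

  prefixSum : ∀ {m} → (Fin m → ℤ) → Fin m → ℤ
  prefixSum a zero    = a zero
  prefixSum a (suc j) = a zero + prefixSum (a ∘ suc) j

  <ᵇ-suc : ∀ x y → (x <ᵇ suc y) ≡ (x ≤ᵇ y)
  <ᵇ-suc zero    y = refl
  <ᵇ-suc (suc x) y = refl

  sumFin-≤ᵇ : ∀ {m} (a : Fin m → ℤ) j →
              sumFin (λ t → if toℕ t ≤ᵇ toℕ j then a t else + 0) ≡ prefixSum a j
  sumFin-≤ᵇ {suc m} a zero    =
    trans (cong (_+_ (a zero)) (sumFin-zero {m} (λ _ → refl))) (ℤ.+-identityʳ (a zero))
  sumFin-≤ᵇ         a (suc j) = cong (_+_ (a zero)) (trans
    (sumFin-cong (λ t → cong (λ b → if b then a (suc t) else + 0) (<ᵇ-suc (toℕ t) (toℕ j))))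
    (sumFin-≤ᵇ (a ∘ suc) j))

  expo≡ : ∀ {m} (a : Fin m → ℤ) j → expo a j ≡ + suc (toℕ j) + prefixSum a j
  expo≡ a j = cong (_+_ (+ suc (toℕ j))) (sumFin-≤ᵇ a j)

  head₀ : ∀ {m} → Vec ℤ m → ℤ
  head₀ []      = + 0
  head₀ (x ∷ _) = x

  suffixSums : ∀ {m} → Vec ℕ m → Vec ℤ m
  suffixSums []       = []
  suffixSums (u ∷ us) = (+ u + head₀ (suffixSums us)) ∷ suffixSums us

  differences : ∀ {m} → Vec ℤ m → Vec ℕ m
  differences []       = []
  differences (x ∷ xs) = ∣ x - head₀ xs ∣ ∷ differences xs

  -- The last entry is also required to be ≥ 0, since head₀ [] = 0.
  NonIncreasing : ∀ {m} → Vec ℤ m → Set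
  NonIncreasing []       = ⊤
  NonIncreasing (x ∷ xs) = head₀ xs ℤ.≤ x × NonIncreasing xs

  suffixSums-nonIncreasing : ∀ {m} (μ : Vec ℕ m) → NonIncreasing (suffixSums μ)
  suffixSums-nonIncreasing []       = tt
  suffixSums-nonIncreasing (u ∷ us) = ℤ.i≤j+i _ (+ u) , suffixSums-nonIncreasing us

  differences-suffixSums : ∀ {m} (μ : Vec ℕ m) → differences (suffixSums μ) ≡ μ
  differences-suffixSums []       = refl
  differences-suffixSums (u ∷ us) =
    cong₂ _∷_ (cong ∣_∣ (x+y-y≡x (+ u) (head₀ (suffixSums us)))) (differences-suffixSums us)

  suffixSums-differences : ∀ {m} (L : Vec ℤ m) → NonIncreasing L →
                           suffixSums (differences L) ≡ L
  suffixSums-differences []       _             = refl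
  suffixSums-differences (x ∷ xs) (x₂≤x , decr) =
    cong₂ _∷_ head≡x (suffixSums-differences xs decr)
    where
    open ≡-Reasoning
    head≡x : + ∣ x - head₀ xs ∣ + head₀ (suffixSums (differences xs)) ≡ x
    head≡x = begin
      + ∣ x - head₀ xs ∣ + head₀ (suffixSums (differences xs))
        ≡⟨ cong₂ _+_ (ℤ.0≤i⇒+∣i∣≡i (ℤ.i≤j⇒0≤j-i x₂≤x))
                     (cong head₀ (suffixSums-differences xs decr)) ⟩
      x - head₀ xs + head₀ xs
        ≡⟨ x-y+y≡x x (head₀ xs) ⟩
      x ∎

  head₀-suffixSums : ∀ {m} (μ : Vec ℕ m) →
                     head₀ (suffixSums μ) ≡ sumFin (λ j → + lookup μ j)
  head₀-suffixSums []       = refl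
  head₀-suffixSums (u ∷ us) = cong (_+_ (+ u)) (head₀-suffixSums us)

  sumFin-*-suffixSums : ∀ {m} (b : Fin m → ℤ) (μ : Vec ℕ m) →
    sumFin (λ i → b i * lookup (suffixSums μ) i) ≡ sumFin (λ j → prefixSum b j * + lookup μ j)
  sumFin-*-suffixSums b []       = refl
  sumFin-*-suffixSums b (u ∷ us) = begin
    b₀ * (+ u + head₀ (suffixSums us)) + sumFin (λ i → b (suc i) * lookup (suffixSums us) i)
      ≡⟨ cong₂ (λ s r → b₀ * (+ u + s) + r)
               (head₀-suffixSums us) (sumFin-*-suffixSums (b ∘ suc) us) ⟩
    b₀ * (+ u + sumFin μ′) + sumFin (λ j → B j * μ′ j)
      ≡⟨ regroup b₀ (+ u) (sumFin μ′) (sumFin (λ j → B j * μ′ j)) ⟩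
    b₀ * + u + (b₀ * sumFin μ′ + sumFin (λ j → B j * μ′ j))
      ≡⟨ cong (λ s → b₀ * + u + (s + sumFin (λ j → B j * μ′ j))) (*-distribˡ-sumFin b₀ μ′) ⟩
    b₀ * + u + (sumFin (λ j → b₀ * μ′ j) + sumFin (λ j → B j * μ′ j))
      ≡⟨ cong (_+_ (b₀ * + u)) (sumFin-+ (λ j → b₀ * μ′ j) (λ j → B j * μ′ j)) ⟨
    b₀ * + u + sumFin (λ j → b₀ * μ′ j + B j * μ′ j)
      ≡⟨ cong (_+_ (b₀ * + u)) (sumFin-cong (λ j → ℤ.*-distribʳ-+ (μ′ j) b₀ (B j))) ⟨
    b₀ * + u + sumFin (λ j → (b₀ + B j) * μ′ j) ∎
    where
    open ≡-Reasoning
    b₀ : ℤ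
    b₀ = b zero
    B μ′ : Fin _ → ℤ
    B = prefixSum (b ∘ suc)
    μ′ j = + lookup us j
    regroup : ∀ c x s r → c * (x + s) + r ≡ c * x + (c * s + r)
    regroup = solve-∀

  pairing : ∀ {m} → (Fin m → ℤ) → Vec ℤ m → ℤ
  pairing a L = sumFin (λ i → a i * lookup L i)

  toP : ∀ {m} → (Fin m → ℤ) → Vec ℕ (suc m) → Vec ℤ (suc m)
  toP a (t ∷ μ) = (+ t + pairing a (suffixSums μ)) ∷ suffixSums μ

  fromP : ∀ {m} → (Fin m → ℤ) → Vec ℤ (suc m) → Vec ℕ (suc m)
  fromP a (x ∷ L) = ∣ x - pairing a L ∣ ∷ differences L

  fromP-toP : ∀ {m} (a : Fin m → ℤ) x → fromP a (toP a x) ≡ x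
  fromP-toP a (t ∷ μ) =
    cong₂ _∷_ (cong ∣_∣ (x+y-y≡x (+ t) (pairing a (suffixSums μ)))) (differences-suffixSums μ)

  toP-injective : ∀ {m} (a : Fin m → ℤ) {x y} → toP a x ≡ toP a y → x ≡ y
  toP-injective a {x} {y} eq =
    trans (sym (fromP-toP a x)) (trans (cong (fromP a) eq) (fromP-toP a y))

  IndexwiseNonIncreasing : ∀ {m} → Vec ℤ (suc m) → Set
  IndexwiseNonIncreasing {m} L =
    ((j : Fin m) → lookup L (suc j) ℤ.≤ lookup L (inject₁ j)) × + 0 ℤ.≤ lookup L (fromℕ m)

  NonIncreasing⇔ : ∀ {m} (L : Vec ℤ (suc m)) → NonIncreasing L ⇔ IndexwiseNonIncreasing L
  NonIncreasing⇔ L = mk⇔ (to L) (from L)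
    where
    to : ∀ {m} (L : Vec ℤ (suc m)) → NonIncreasing L → IndexwiseNonIncreasing L
    to (x ∷ [])     (0≤x , _)    = (λ ()) , 0≤x
    to (x ∷ y ∷ ys) (y≤x , decr) with to (y ∷ ys) decr
    ... | steps , 0≤last = (λ { zero → y≤x ; (suc j) → steps j }) , 0≤last
    from : ∀ {m} (L : Vec ℤ (suc m)) → IndexwiseNonIncreasing L → NonIncreasing L
    from (x ∷ [])     (_     , 0≤x)    = 0≤x , tt
    from (x ∷ y ∷ ys) (steps , 0≤last) = steps zero , from (y ∷ ys) (steps ∘ suc , 0≤last)

  InP-∷ : ∀ {m} (a : Fin (suc m) → ℤ) x L →
          InP a (x ∷ L) ⇔ (pairing a L ℤ.≤ x × NonIncreasing L)
  InP-∷ a x L = mk⇔ to from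
    where
    open Equivalence (NonIncreasing⇔ L) renaming (to to unfold; from to fold)
    to : InP a (x ∷ L) → pairing a L ℤ.≤ x × NonIncreasing L
    to (p≤x , steps , 0≤last) = p≤x , fold ((λ j → steps (suc j) (s≤s z≤n)) , 0≤last)
    from : pairing a L ℤ.≤ x × NonIncreasing L → InP a (x ∷ L)
    from (p≤x , decr) = p≤x , steps , proj₂ (unfold decr)
      where
      steps : (j : Fin (suc _)) → 1 ℕ.≤ toℕ j →
              lookup (x ∷ L) (suc j) ℤ.≤ lookup (x ∷ L) (inject₁ j)
      steps (suc j) _ = proj₁ (unfold decr) j

  toP-InP : ∀ {m} (a : Fin (suc m) → ℤ) x → InP a (toP a x)
  toP-InP a (t ∷ μ) = Equivalence.from (InP-∷ a _ (suffixSums μ))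
    (ℤ.i≤j+i (pairing a (suffixSums μ)) (+ t) , suffixSums-nonIncreasing μ)

  toP-fromP : ∀ {m} (a : Fin (suc m) → ℤ) lam → InP a lam → toP a (fromP a lam) ≡ lam
  toP-fromP a (x ∷ L) lam∈P with Equivalence.to (InP-∷ a x L) lam∈P
  ... | p≤x , decr = begin
    (+ ∣ x - pairing a L ∣ + pairing a (suffixSums (differences L))) ∷ suffixSums (differences L)
      ≡⟨ cong (λ L′ → (+ ∣ x - pairing a L ∣ + pairing a L′) ∷ L′)
              (suffixSums-differences L decr) ⟩
    (+ ∣ x - pairing a L ∣ + pairing a L) ∷ L
      ≡⟨ cong (λ d → (d + pairing a L) ∷ L) (ℤ.0≤i⇒+∣i∣≡i (ℤ.i≤j⇒0≤j-i p≤x)) ⟩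
    (x - pairing a L + pairing a L) ∷ L
      ≡⟨ cong (_∷ L) (x-y+y≡x x (pairing a L)) ⟩
    x ∷ L ∎
    where open ≡-Reasoning

  prefixSum-one : ∀ {m} (j : Fin m) → prefixSum (λ _ → + 1) j ≡ + suc (toℕ j)
  prefixSum-one zero    = refl
  prefixSum-one (suc j) = cong (_+_ (+ 1)) (prefixSum-one j)

  sumFin-suffixSums : ∀ {m} (μ : Vec ℕ m) →
    sumFin (lookup (suffixSums μ)) ≡ sumFin (λ j → + suc (toℕ j) * + lookup μ j)
  sumFin-suffixSums μ = begin
    sumFin (lookup (suffixSums μ))
      ≡⟨ sumFin-cong (λ i → sym (ℤ.*-identityˡ (lookup (suffixSums μ) i))) ⟩
    sumFin (λ i → + 1 * lookup (suffixSums μ) i)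
      ≡⟨ sumFin-*-suffixSums (λ _ → + 1) μ ⟩
    sumFin (λ j → prefixSum (λ _ → + 1) j * + lookup μ j)
      ≡⟨ sumFin-cong (λ j → cong (_* + lookup μ j) (prefixSum-one j)) ⟩
    sumFin (λ j → + suc (toℕ j) * + lookup μ j) ∎
    where open ≡-Reasoning

  weight-toP : ∀ {m} (a : Fin m → ℤ) t μ →
               weight (toP a (t ∷ μ)) ≡ + t + sumFin (λ j → expo a j * + lookup μ j)
  weight-toP a t μ = begin
    + t + pairing a (suffixSums μ) + sumFin (lookup (suffixSums μ))
      ≡⟨ ℤ.+-assoc (+ t) (pairing a (suffixSums μ)) (sumFin (lookup (suffixSums μ))) ⟩
    + t + (pairing a (suffixSums μ) + sumFin (lookup (suffixSums μ)))
      ≡⟨ cong (_+_ (+ t)) (cong₂ _+_ (sumFin-*-suffixSums a μ) (sumFin-suffixSums μ)) ⟩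
    + t + (sumFin (λ j → prefixSum a j * μ′ j) + sumFin (λ j → + suc (toℕ j) * μ′ j))
      ≡⟨ cong (_+_ (+ t)) (sumFin-+ (λ j → prefixSum a j * μ′ j) (λ j → + suc (toℕ j) * μ′ j)) ⟨
    + t + sumFin (λ j → prefixSum a j * μ′ j + + suc (toℕ j) * μ′ j)
      ≡⟨ cong (_+_ (+ t)) (sumFin-cong coefficient) ⟩
    + t + sumFin (λ j → expo a j * μ′ j) ∎
    where
    open ≡-Reasoning
    μ′ : Fin _ → ℤ
    μ′ j = + lookup μ j
    coefficient : ∀ j → prefixSum a j * μ′ j + + suc (toℕ j) * μ′ j ≡ expo a j * μ′ j
    coefficient j = begin
      prefixSum a j * μ′ j + + suc (toℕ j) * μ′ j
        ≡⟨ ℤ.*-distribʳ-+ (μ′ j) (prefixSum a j) (+ suc (toℕ j)) ⟨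
      (prefixSum a j + + suc (toℕ j)) * μ′ j
        ≡⟨ cong (_* μ′ j) (trans (ℤ.+-comm (prefixSum a j) (+ suc (toℕ j))) (sym (expo≡ a j))) ⟩
      expo a j * μ′ j ∎

  unit : ∀ {m} → Fin m → Vec ℕ m
  unit {suc m} zero    = 1 ∷ replicate m 0
  unit         (suc j) = 0 ∷ unit j

  sumFin-*-unit : ∀ {m} (f : Fin m → ℤ) j → sumFin (λ k → f k * + lookup (unit j) k) ≡ f j
  sumFin-*-unit {suc m} f zero    = begin
    f zero * + 1 + sumFin (λ k → f (suc k) * + lookup (replicate m 0) k)
      ≡⟨ cong₂ _+_ (ℤ.*-identityʳ (f zero)) (sumFin-zero vanish) ⟩
    f zero + + 0
      ≡⟨ ℤ.+-identityʳ (f zero) ⟩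
    f zero ∎
    where
    open ≡-Reasoning
    vanish : ∀ k → f (suc k) * + lookup (replicate m 0) k ≡ + 0
    vanish k = trans (cong (λ z → f (suc k) * + z) (lookup-replicate k 0)) (ℤ.*-zeroʳ (f (suc k)))
  sumFin-*-unit         f (suc j) =
    trans (cong (_+ sumFin (λ k → f (suc k) * + lookup (unit j) k)) (ℤ.*-zeroʳ (f zero)))
          (trans (ℤ.+-identityˡ (sumFin (λ k → f (suc k) * + lookup (unit j) k)))
                 (sumFin-*-unit (f ∘ suc) j))

  -- λ₁ of the element with tail (1, …, 1, 0, …, 0) (j + 1 ones) and t = 0 is a₁ + ⋯ + aⱼ₊₁.
  prefixSum-nonneg : ∀ {m} (a : Fin (suc m) → ℤ) →
    ((lam : Vec ℤ (suc (suc m))) → InP a lam → (i : Fin (suc (suc m))) → + 0 ℤ.≤ lookup lam i) →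
    ∀ j → + 0 ℤ.≤ prefixSum a j
  prefixSum-nonneg a P≥0 j =
    subst (+ 0 ℤ.≤_) head≡prefixSum (P≥0 (toP a (0 ∷ unit j)) (toP-InP a (0 ∷ unit j)) zero)
    where
    head≡prefixSum : + 0 + pairing a (suffixSums (unit j)) ≡ prefixSum a j
    head≡prefixSum = trans (ℤ.+-identityˡ _)
                           (trans (sumFin-*-suffixSums a (unit j)) (sumFin-*-unit (prefixSum a) j))

open IntegerSums using (sumFin-cong)
open FormalSeries using (≈ₛ-trans; *ₛ-congʳ; prodFin-cong)
open Partitions
open Parametrisation

import Data.Nat as ℕ
import Data.Nat.Properties as ℕ
import Data.Integer as ℤ
import Data.Integer.Properties as ℤ
open import Data.Fin using (toℕ)
open import Data.Vec using (_∷_; tabulate)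
open import Data.Vec.Properties using (lookup∘tabulate)
open import Data.List using (map)
open import Data.List.Properties using (length-map)
open import Data.List.Membership.Propositional.Properties using (∈-map⁺; ∈-map⁻)
import Data.List.Relation.Unary.Unique.Propositional.Properties as Unique
open import Data.Product using (_,_)
open import Function.Bundles using (mk⇔)
open import Relation.Binary.PropositionalEquality
  using (refl; sym; trans; cong; cong₂; subst; module ≡-Reasoning)

weight-toP≡size : ∀ {m} (a : Fin m → ℤ) (ws : Vec ℕ m) →
                  (∀ j → expo a j ≡ + suc (lookup ws j)) →
                  ∀ x → weight (toP a x) ≡ + size (0 ∷ ws) x
weight-toP≡size a ws expo≡ws (t ∷ μ) = begin
  weight (toP a (t ∷ μ))
    ≡⟨ weight-toP a t μ ⟩
  + t ℤ.+ sumFin (λ j → expo a j ℤ.* + lookup μ j)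
    ≡⟨ cong₂ ℤ._+_ (cong +_ (sym (ℕ.*-identityʳ t)))
                   (trans (sumFin-cong (λ j → cong (ℤ._* + lookup μ j) (expo≡ws j)))
                          (sym (+size ws μ))) ⟩
  + (t ℕ.* 1) ℤ.+ + size ws μ
    ≡⟨ ℤ.pos-+ (t ℕ.* 1) (size ws μ) ⟨
  + size (0 ∷ ws) (t ∷ μ) ∎
  where open ≡-Reasoning

∈-map-toP-partitions : ∀ {m} (a : Fin (suc m) → ℤ) (ws : Vec ℕ (suc m)) →
  (∀ j → expo a j ≡ + suc (lookup ws j)) →
  ∀ n lam → (lam ∈ map (toP a) (partitions (0 ∷ ws) n)) ⇔ (InP a lam × weight lam ≡ + n)
∈-map-toP-partitions a ws expo≡ws n lam = mk⇔ to from
  where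
  open ≡-Reasoning
  to : lam ∈ map (toP a) (partitions (0 ∷ ws) n) → InP a lam × weight lam ≡ + n
  to lam∈ with ∈-map⁻ (toP a) lam∈
  ... | x , x∈ , refl =
    toP-InP a x , trans (weight-toP≡size a ws expo≡ws x) (cong +_ (partitions-sound x∈))
  from : InP a lam × weight lam ≡ + n → lam ∈ map (toP a) (partitions (0 ∷ ws) n)
  from (lam∈P , weight≡n) =
    subst (_∈ map (toP a) (partitions (0 ∷ ws) n)) (toP-fromP a lam lam∈P)
    (∈-map⁺ (toP a) (partitions-complete (ℤ.+-injective (begin
      + size (0 ∷ ws) (fromP a lam)    ≡⟨ weight-toP≡size a ws expo≡ws (fromP a lam) ⟨
      weight (toP a (fromP a lam))     ≡⟨ cong weight (toP-fromP a lam lam∈P) ⟩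
      weight lam                       ≡⟨ weight≡n ⟩
      + n                              ∎))))

elementsOfWeight : ∀ {m} (a : Fin (suc m) → ℤ) (ws : Vec ℕ (suc m)) →
  (∀ j → expo a j ≡ + suc (lookup ws j)) → ∀ n →
  Σ (List (Vec ℤ (suc (suc m)))) (λ xs →
    Unique xs
    × ((lam : Vec ℤ (suc (suc m))) → (lam ∈ xs) ⇔ (InP a lam × weight lam ≡ + n))
    × length xs ≡ length (partitions (0 ∷ ws) n))
elementsOfWeight a ws expo≡ws n =
  map (toP a) (partitions (0 ∷ ws) n)
  , Unique.map⁺ (toP-injective a) (partitions-unique (0 ∷ ws) n)
  , ∈-map-toP-partitions a ws expo≡ws n
  , length-map (toP a) (partitions (0 ∷ ws) n)

denominator≈prodFin : ∀ {m} (a : Fin m → ℤ) (ws : Vec ℕ m) →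
  (∀ j → expo a j ≡ + suc (lookup ws j)) →
  denominator a ≈ₛ prodFin (λ j → oneₛ -ₛ qpow (+ suc (lookup (0 ∷ ws) j)))
denominator≈prodFin a ws expo≡ws = *ₛ-congʳ (oneₛ -ₛ qpow (+ 1))
  (prodFin-cong (λ j n → cong (λ e → (oneₛ -ₛ qpow e) n) (expo≡ws j)))

natExponents : ∀ {m} → (Fin m → ℤ) → Vec ℕ m
natExponents a = tabulate (λ j → toℕ j ℕ.+ ℤ.∣ prefixSum a j ∣)

expo≡natExponents : ∀ {m} (a : Fin m → ℤ) → (∀ j → + 0 ℤ.≤ prefixSum a j) →
                    ∀ j → expo a j ≡ + suc (lookup (natExponents a) j)
expo≡natExponents a prefixSum≥0 j = begin
  expo a j
    ≡⟨ expo≡ a j ⟩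
  + suc (toℕ j) ℤ.+ prefixSum a j
    ≡⟨ cong (ℤ._+_ (+ suc (toℕ j))) (ℤ.0≤i⇒+∣i∣≡i (prefixSum≥0 j)) ⟨
  + suc (toℕ j) ℤ.+ + ℤ.∣ prefixSum a j ∣
    ≡⟨ cong (λ k → + suc k) (lookup∘tabulate (λ j → toℕ j ℕ.+ ℤ.∣ prefixSum a j ∣) j) ⟨
  + suc (lookup (natExponents a) j) ∎
  where open ≡-Reasoning

corollary4 : (m : ℕ) → 1 ≤ m → (a : Fin m → ℤ)
    → ((lam : Vec ℤ (suc m)) → InP a lam → (i : Fin (suc m)) → (+ 0) Data.Integer.≤ lookup lam i)
    → Σ (ℕ → ℕ) (λ c →
        ((n : ℕ) → Σ (List (Vec ℤ (suc m))) (λ xs →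
            Unique xs
            × ((lam : Vec ℤ (suc m)) → (lam ∈ xs) ⇔ (InP a lam × weight lam ≡ + n))
            × length xs ≡ c n))
        × (((λ n → + c n) *ₛ denominator a) ≈ₛ oneₛ))
corollary4 (suc m) (ℕ.s≤s ℕ.z≤n) a P≥0 =
  count , elementsOfWeight a ws expo≡ws , generating
  where
  ws : Vec ℕ (suc m)
  ws = natExponents a
  expo≡ws : ∀ j → expo a j ≡ + suc (lookup ws j)
  expo≡ws = expo≡natExponents a (prefixSum-nonneg a P≥0)
  count : ℕ → ℕ
  count n = length (partitions (0 ∷ ws) n)
  generating : ((λ n → + count n) *ₛ denominator a) ≈ₛ oneₛ
  generating = ≈ₛ-trans (*ₛ-congʳ (partitionSeries (0 ∷ ws)) (denominator≈prodFin a ws expo≡ws))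
                        (partitionSeries-generating (0 ∷ ws))
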